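{- Let $(s_{n,k})$ be defined by $s_{n,n}=1$ for $n\ge0$, $s_{n,k}=0$ for $n<k$ or $n<0$ or $k<0$, and $s_{n,k}=s_{n-1,k-1}+3s_{n-1,k}+2s_{n-1,k+1}$ otherwise (for $n>k\ge 0$), and let $s_n=s_{n,0}$ (the little Schröder numbers). Then for all integers $n,m\ge 0$, $$\sum_{k=0}^{m}2^k\det\begin{pmatrix}s_{n,k}&s_{m,k+1}\\ s_{n+1,k}&s_{m+1,k+1}\end{pmatrix}=s_ns_m.$$ -}

module Defs where

open import Data.Nat using (ℕ; zero; suc; _<ᵇ_; _≡ᵇ_)
open import Data.Bool using (if_then_else_)
open import Data.Integer using (ℤ; +_; _+_; _*_; _-_)

-- s n k = s_{n,k} (the paper's triangle), negative indices handled as 0.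
-- sPrev n k' stands for s_{n, k'-1}, i.e. the term with k-1 (0 when k = 0).
s : ℕ → ℕ → ℤ
s zero zero = + 1
s zero (suc k) = + 0
s (suc n) k =
  if suc n <ᵇ k then + 0
  else if (suc n ≡ᵇ k) then + 1
  else (prev k + (+ 3) * s n k + (+ 2) * s n (suc k))
  where
  prev : ℕ → ℤ
  prev zero = + 0
  prev (suc j) = s n j

sₙ : ℕ → ℤ
sₙ n = s n 0

det2 : ℤ → ℤ → ℤ → ℤ → ℤ
det2 a b c d = a * d - b * c

Σ≤ : ℕ → (ℕ → ℤ) → ℤ
Σ≤ zero f = f 0
Σ≤ (suc m) f = Σ≤ m f + f (suc m)

-- Since s_{n,k} = 0 for k > n, the recurrence holds for every k ≥ 0 once s_{n,−1} := 0.
-- Expanding s_{n+1,k} and s_{m+1,k+1} by it in the k-th summand, the terms with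
-- coefficient 3 cancel and the summand becomes G k − G (k+1) for
--   G k = 2^k (s_{n,k} s_{m,k} − s_{n,k−1} s_{m,k+1}).
-- The sum telescopes to G 0 − G (m+1) = s_n s_m − 0.
module Submission where

open import Defs
open import Data.Bool using (true; false; T)
open import Data.Empty using (⊥-elim)
open import Data.Nat using (ℕ; zero; suc; _<_; _<ᵇ_; _≡ᵇ_; s<s)
open import Data.Nat.Properties using (<ᵇ-reflects-<; ≡⇒≡ᵇ; ≡ᵇ⇒≡; <⇒<ᵇ; <ᵇ⇒<; <-irrefl; n<1+n; m<n⇒m<1+n)
open import Data.Integer using (ℤ; +_; _+_; _-_; _*_; _^_)
open import Data.Integer.Properties using (*-identityˡ; +-identityʳ; *-zeroʳ; +-minus-telescope)
open import Data.Integer.Tactic.RingSolver using (solve-∀)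
open import Data.Unit using (tt)
open import Relation.Nullary.Reflects using (ofʸ)
open import Relation.Binary.PropositionalEquality using (_≡_; refl; sym; trans; cong; cong₂; subst; module ≡-Reasoning)

Σ≤-telescope : {f g : ℕ → ℤ} → (∀ k → f k ≡ g k - g (suc k)) → ∀ M → Σ≤ M f ≡ g 0 - g (suc M)
Σ≤-telescope f≡Δg zero = f≡Δg 0
Σ≤-telescope {f} {g} f≡Δg (suc M) = begin
  Σ≤ M f + f (suc M)                                ≡⟨ cong₂ _+_ (Σ≤-telescope {g = g} f≡Δg M) (f≡Δg (suc M)) ⟩
  (g 0 - g (suc M)) + (g (suc M) - g (suc (suc M))) ≡⟨ +-minus-telescope (g 0) (g (suc M)) (g (suc (suc M))) ⟩
  g 0 - g (suc (suc M))                             ∎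
  where open ≡-Reasoning

s-vanish : ∀ {n k} → n < k → s n k ≡ + 0
s-vanish {zero} {suc k} _ = refl
s-vanish {suc n} {k} n<k with suc n <ᵇ k | <⇒<ᵇ n<k
... | true | _ = refl

s-diag : ∀ n → s n n ≡ + 1
s-diag zero = refl
s-diag (suc n) with n <ᵇ n | <ᵇ-reflects-< n n
... | true | ofʸ n<n = ⊥-elim (<-irrefl refl n<n)
... | false | _ with n ≡ᵇ n | ≡⇒≡ᵇ n n refl
...   | true | _ = refl

sPrev : ℕ → ℕ → ℤ
sPrev n zero = + 0
sPrev n (suc k) = s n k

s-rec : ∀ n k → s (suc n) k ≡ sPrev n k + + 3 * s n k + + 2 * s n (suc k)
s-rec n k with suc n <ᵇ k in above | suc n ≡ᵇ k in diagonal
... | true | _ = sym (vanish k (<ᵇ⇒< (suc n) k (subst T (sym above) tt)))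
  where
  vanish : ∀ j → suc n < j → sPrev n j + + 3 * s n j + + 2 * s n (suc j) ≡ + 0
  vanish (suc j) (s<s n<j) rewrite s-vanish n<j | s-vanish (m<n⇒m<1+n n<j) | s-vanish (m<n⇒m<1+n (m<n⇒m<1+n n<j)) = refl
... | false | true with ≡ᵇ⇒≡ (suc n) k (subst T (sym diagonal) tt)
...   | refl rewrite s-diag n | s-vanish (n<1+n n) | s-vanish (m<n⇒m<1+n (n<1+n n)) = refl
s-rec n zero | false | false = refl
s-rec n (suc k) | false | false = refl

module _ (n m : ℕ) where

  summand : ℕ → ℤ
  summand k = (+ 2) ^ k * det2 (s n k) (s m (suc k)) (s (suc n) k) (s (suc m) (suc k))

  G : ℕ → ℤ
  G k = (+ 2) ^ k * (s n k * s m k - sPrev n k * s m (suc k))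

  summand≡ΔG : ∀ k → summand k ≡ G k - G (suc k)
  summand≡ΔG k rewrite s-rec n k | s-rec m (suc k) =
    cancel-threes ((+ 2) ^ k) (s n k) (sPrev n k) (s n (suc k)) (s m k) (s m (suc k)) (s m (suc (suc k)))
    where
    cancel-threes : ∀ p a b c x y z →
      p * (a * (x + + 3 * y + + 2 * z) - y * (b + + 3 * a + + 2 * c))
        ≡ p * (a * x - b * y) - + 2 * p * (c * y - a * z)
    cancel-threes = solve-∀

  G-zero : G 0 ≡ sₙ n * sₙ m
  G-zero = trans (*-identityˡ _) (+-identityʳ _)

  G-vanish : ∀ {k} → m < k → G k ≡ + 0
  G-vanish {k} m<k
    rewrite s-vanish m<k | s-vanish (m<n⇒m<1+n m<k) | *-zeroʳ (s n k) | *-zeroʳ (sPrev n k) = *-zeroʳ ((+ 2) ^ k)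

corollary2p2 : (n m : ℕ) → Σ≤ m (λ k → (+ 2) ^ k * det2 (s n k) (s m (suc k)) (s (suc n) k) (s (suc m) (suc k))) ≡ sₙ n * sₙ m
corollary2p2 n m = begin
  Σ≤ m (summand n m)                 ≡⟨ Σ≤-telescope {g = G n m} (summand≡ΔG n m) m ⟩
  G n m 0 - G n m (suc m)            ≡⟨ cong₂ _-_ (G-zero n m) (G-vanish n m (n<1+n m)) ⟩
  sₙ n * sₙ m - + 0                  ≡⟨ +-identityʳ (sₙ n * sₙ m) ⟩
  sₙ n * sₙ m                        ∎
  where open ≡-Reasoning
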